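{- Let $q$ be a prime power, $m,n$ positive integers and $k\ge2$ an integer. Let $\mathcal{U}$ be an $[n,k]_{q^m/q}$ system which is a linear cutting blocking set. Then $\mathcal{U}$, regarded as an $\mathbb{F}_q$-subspace of $\mathbb{F}_{q^{m(k-1)}}^k$ via $\mathbb{F}_{q^m}\subseteq\mathbb{F}_{q^{m(k-1)}}$, is a rank-$(k-1)$-saturating $[n,k]_{q^{m(k-1)}/q}$ system.
   Context: For an extension $\mathbb{F}_{Q}$ of $\mathbb{F}_q$, an $[n,k]_{Q/q}$ system is an $n$-dimensional $\mathbb{F}_q$-subspace $\mathcal{U}\le\mathbb{F}_{Q}^k$ with $\langle\mathcal{U}\rangle_{\mathbb{F}_{Q}}=\mathbb{F}_{Q}^k$; its linear set is $L_\mathcal{U}=\{\langle u\rangle_{\mathbb{F}_Q}:u\in\mathcal{U}\setminus\{0\}\}\subseteq\mathrm{PG}(k-1,Q)$. A point set of $\mathrm{PG}(k-1,Q)$ is $r$-saturating if every point lies in the span of some $r+1$ of its points and $r$ is minimal with this property; $\mathcal{U}$ is rank-$\rho$-saturating if $L_\mathcal{U}$ is $(\rho-1)$-saturating. An $[n,k]_{q^m/q}$ system $\mathcal{U}$ is a linear cutting blocking set if for every $\mathbb{F}_{q^m}$-hyperplane $\mathcal{H}$ of $\mathbb{F}_{q^m}^k$ one has $\langle\mathcal{H}\cap\mathcal{U}\rangle_{\mathbb{F}_{q^m}}=\mathcal{H}$. -}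

module Defs where

open import Level using (0ℓ)
open import Algebra.Bundles using (CommutativeRing)
open import Data.Nat using (ℕ; zero; suc; _<_; _≤_; _^_; _∸_)
open import Data.Nat.Primality using (Prime)
open import Data.Fin using (Fin)
import Data.Fin as Fin
open import Data.Product using (Σ; ∃; _×_; _,_)
open import Relation.Nullary using (¬_)
open import Relation.Binary.PropositionalEquality using (_≡_)

record Field : Set₁ where
  field
    commutativeRing : CommutativeRing 0ℓ 0ℓ
  open CommutativeRing commutativeRing public
  field
    0≉1     : ¬ (0# ≈ 1#)
    inverse : ∀ x → ¬ (x ≈ 0#) → ∃ λ y → (x * y) ≈ 1#

open Field

HasSize : Field → ℕ → Set
HasSize F N =
  Σ (Fin N → Carrier F) λ e →
    (∀ i j → _≈_ F (e i) (e j) → i ≡ j) × (∀ x → ∃ λ i → _≈_ F (e i) x)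

IsPrimePower : ℕ → Set
IsPrimePower q = ∃ λ p → ∃ λ e → Prime p × 1 ≤ e × q ≡ p ^ e

-- Field homomorphisms (= field embeddings F ↪ K, exhibiting K as an extension of F).
record FieldHom (F K : Field) : Set where
  field
    ⟦_⟧     : Carrier F → Carrier K
    cong    : ∀ {x y} → _≈_ F x y → _≈_ K ⟦ x ⟧ ⟦ y ⟧
    hom-+   : ∀ x y → _≈_ K ⟦ _+_ F x y ⟧ (_+_ K ⟦ x ⟧ ⟦ y ⟧)
    hom-*   : ∀ x y → _≈_ K ⟦ _*_ F x y ⟧ (_*_ K ⟦ x ⟧ ⟦ y ⟧)
    hom-1   : _≈_ K ⟦ 1# F ⟧ (1# K)

open FieldHom

_∘ₕ_ : ∀ {F K L} → FieldHom K L → FieldHom F K → FieldHom F L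
_∘ₕ_ {F} {K} {L} g f = record
  { ⟦_⟧   = λ x → ⟦ g ⟧ (⟦ f ⟧ x)
  ; cong  = λ e → cong g (cong f e)
  ; hom-+ = λ x y → trans L (cong g (hom-+ f x y)) (hom-+ g _ _)
  ; hom-* = λ x y → trans L (cong g (hom-* f x y)) (hom-* g _ _)
  ; hom-1 = trans L (cong g (hom-1 f)) (hom-1 g)
  }

-- Vectors in K^k (field arguments are explicit since Vect K k does not determine K)

Vect : Field → ℕ → Set
Vect K k = Fin k → Carrier K

EqV : (K : Field) {k : ℕ} → Vect K k → Vect K k → Set
EqV K u v = ∀ i → _≈_ K (u i) (v i)

0v : (K : Field) {k : ℕ} → Vect K k
0v K = λ _ → 0# K

addV : (K : Field) {k : ℕ} → Vect K k → Vect K k → Vect K k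
addV K u v = λ i → _+_ K (u i) (v i)

scaleV : (K : Field) {k : ℕ} → Carrier K → Vect K k → Vect K k
scaleV K a v = λ i → _*_ K a (v i)

sumK : (K : Field) (t : ℕ) → (Fin t → Carrier K) → Carrier K
sumK K zero    f = 0# K
sumK K (suc t) f = _+_ K (f Fin.zero) (sumK K t (λ i → f (Fin.suc i)))

lincomb : (K : Field) {k : ℕ} (t : ℕ) → (Fin t → Carrier K) → (Fin t → Vect K k) → Vect K k
lincomb K t c w = λ j → sumK K t (λ i → _*_ K (c i) (w i j))

InSpanFam : (K : Field) {k t : ℕ} → (Fin t → Vect K k) → Vect K k → Set
InSpanFam K {k} {t} w v = ∃ λ (c : Fin t → Carrier K) → EqV K v (lincomb K t c w)

InSpan : (K : Field) {k : ℕ} → (Vect K k → Set) → Vect K k → Set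
InSpan K {k} S v =
  ∃ λ t → ∃ λ (w : Fin t → Vect K k) → (∀ i → S (w i)) × InSpanFam K w v

record IsFSubspace {F K : Field} (ι : FieldHom F K) (k : ℕ) (U : Vect K k → Set) : Set where
  field
    resp     : ∀ {u v} → EqV K u v → U u → U v
    zero∈    : U (0v K)
    +-closed : ∀ {u v} → U u → U v → U (addV K u v)
    ·-closed : ∀ (a : Carrier F) {u} → U u → U (scaleV K (⟦ ι ⟧ a) u)

HasFDim : {F K : Field} (ι : FieldHom F K) (k n : ℕ) (U : Vect K k → Set) → Set
HasFDim {F} {K} ι k n U =
  ∃ λ (b : Fin n → Vect K k) →
    (∀ i → U (b i)) ×
    (∀ (a : Fin n → Carrier F) → EqV K (lincomb K n (λ i → ⟦ ι ⟧ (a i)) b) (0v K)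
        → ∀ i → _≈_ F (a i) (0# F)) ×
    (∀ u → U u → ∃ λ (a : Fin n → Carrier F) → EqV K u (lincomb K n (λ i → ⟦ ι ⟧ (a i)) b))

-- [n,k]_{K/F} system: n-dim F-subspace U of K^k with ⟨U⟩_K = K^k
IsSystem : {F K : Field} (ι : FieldHom F K) (n k : ℕ) (U : Vect K k → Set) → Set
IsSystem {F} {K} ι n k U =
  IsFSubspace ι k U × HasFDim ι k n U × (∀ (v : Vect K k) → InSpan K U v)

-- Every point ⟨v⟩ of PG(k-1,K) lies in the span of r+1 points of L_U
-- (repetitions allowed, i.e. at most r+1 distinct points), a point of
-- L_U being ⟨u⟩_K for a nonzero u ∈ U.
CoversWith : (K : Field) {k : ℕ} → (Vect K k → Set) → ℕ → Set
CoversWith K {k} U r =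
  ∀ (v : Vect K k) → ¬ EqV K v (0v K) →
    ∃ λ (u : Fin (suc r) → Vect K k) →
      (∀ i → U (u i) × ¬ EqV K (u i) (0v K)) × InSpanFam K u v

LinSetSaturating : (K : Field) {k : ℕ} → (Vect K k → Set) → ℕ → Set
LinSetSaturating K U r = CoversWith K U r × (∀ s → s < r → ¬ CoversWith K U s)

-- U is rank-ρ-saturating: L_U is (ρ-1)-saturating (used with ρ ≥ 1)
RankSaturating : (K : Field) {k : ℕ} → (Vect K k → Set) → ℕ → Set
RankSaturating K U ρ = LinSetSaturating K U (ρ ∸ 1)

InHyperplane : (K : Field) {k : ℕ} → Vect K k → Vect K k → Set
InHyperplane K {k} a v = _≈_ K (sumK K k (λ i → _*_ K (a i) (v i))) (0# K)

-- for every K-hyperplane H of K^k, ⟨H ∩ U⟩_K = H  (⊇ is automatic)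
IsCutting : (K : Field) {k : ℕ} → (Vect K k → Set) → Set
IsCutting K {k} U =
  ∀ (a : Vect K k) → ¬ EqV K a (0v K) →
    ∀ v → InHyperplane K a v → InSpan K (λ u → U u × InHyperplane K a u) v

ImageVec : {K L : Field} {k : ℕ} → FieldHom K L → (Vect K k → Set) → Vect L k → Set
ImageVec {K} {L} {k} j U w = ∃ λ u → U u × EqV L w (λ i → ⟦ j ⟧ (u i))

-- Let ξ₁, …, ξ_{k-1} be an F_{q^m}-basis of Q = F_{q^{m(k-1)}}; it has exactly k - 1 elements because
-- |Q| = |F_{q^m}|^{k-1}. A nonzero v ∈ Q^k equals Σₜ ξₜ wₜ with wₜ ∈ F_{q^m}^k. These k - 1 vectors lie
-- in a common hyperplane H, and since U cuts H they lie in the F_{q^m}-span of at most k - 1 independent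
-- vectors of U ∩ H, which then span v over Q. Conversely, writing the Q-coefficients of a cover of
-- (0, ξ₁, …, ξ_{k-1}) in the basis ξ yields k - 1 independent vectors of F_{q^m}^k in the F_{q^m}-span of
-- the covering vectors, so fewer than k - 1 points never suffice. U remains an [n,k] system over Q because
-- a field embedding is injective and U spans the standard basis vectors. Every dimension bound comes from
-- counting: an injective map F^a → F^b between finite sets forces a ≤ b.

module Submission where

open import Level using (0ℓ)
open import Data.Nat as ℕ using (ℕ; zero; suc; _≤_; _<_; _^_; _∸_; z≤n; s≤s)
import Data.Nat.Properties as ℕ
open import Data.Fin as Fin using (Fin; punchIn; punchOut; finToFun; funToFin)
open import Data.Fin.Properties
  using (punchInᵢ≢i; punchIn-punchOut; ¬∀⟶∃¬; any?; all?; injective⇒≤; pigeonhole; <⇒≢; finToFun-funToFin; funToFin-finToFin)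
open import Data.Vec.Functional.Relation.Binary.Equality.Setoid using (≋-setoid)
open import Data.Product using (∃; _×_; _,_; proj₁; proj₂)
open import Data.Unit using (⊤; tt)
open import Function using (_∘_)
open import Data.Vec.Functional using (_∷_)
open import Relation.Nullary using (¬_; Dec; yes; no; contradiction)
open import Relation.Binary.Bundles using (Setoid)
open import Relation.Binary.Definitions using (Decidable)
open import Relation.Binary.PropositionalEquality as ≡ using (_≡_; _≢_; _≗_)
import Algebra.Properties.Ring as RingProperties
import Algebra.Properties.Semiring.Sum as SemiringSum
import Relation.Binary.Reasoning.Setoid as SetoidReasoning

open import Defs

module FiniteSums (K : Field) where
  open Field K
  open SemiringSum semiring using (sum; sum-cong-≋; sum-replicate-zero; ∑-distrib-+; sum-remove; *-distribˡ-sum; *-distribʳ-sum)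
  open RingProperties ring using (-‿+-comm; -0#≈0#)

  sumK≡sum : ∀ t (f : Fin t → Carrier) → sumK K t f ≡ sum f
  sumK≡sum zero    f = ≡.refl
  sumK≡sum (suc t) f = ≡.cong (f Fin.zero +_) (sumK≡sum t (f ∘ Fin.suc))

  sumK-cong : ∀ t {f g : Fin t → Carrier} → (∀ i → f i ≈ g i) → sumK K t f ≈ sumK K t g
  sumK-cong t {f} {g} f≈g rewrite sumK≡sum t f | sumK≡sum t g = sum-cong-≋ f≈g

  sumK-zero : ∀ t {f : Fin t → Carrier} → (∀ i → f i ≈ 0#) → sumK K t f ≈ 0#
  sumK-zero t f≈0 = trans (sumK-cong t f≈0) (trans (reflexive (sumK≡sum t _)) (sum-replicate-zero t))

  sumK-distrib-+ : ∀ t (f g : Fin t → Carrier) → sumK K t (λ i → f i + g i) ≈ sumK K t f + sumK K t g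
  sumK-distrib-+ t f g rewrite sumK≡sum t f | sumK≡sum t g | sumK≡sum t (λ i → f i + g i) = ∑-distrib-+ f g

  sumK-comm : ∀ s t (f : Fin s → Fin t → Carrier) →
    sumK K s (λ i → sumK K t (f i)) ≈ sumK K t (λ j → sumK K s (λ i → f i j))
  sumK-comm zero    t f = sym (sumK-zero t (λ _ → refl))
  sumK-comm (suc s) t f = trans (+-congˡ (sumK-comm s t (f ∘ Fin.suc))) (sym (sumK-distrib-+ t _ _))

  *-distribˡ-sumK : ∀ t a (f : Fin t → Carrier) → a * sumK K t f ≈ sumK K t (λ i → a * f i)
  *-distribˡ-sumK t a f rewrite sumK≡sum t f | sumK≡sum t (λ i → a * f i) = *-distribˡ-sum a f

  *-distribʳ-sumK : ∀ t a (f : Fin t → Carrier) → sumK K t f * a ≈ sumK K t (λ i → f i * a)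
  *-distribʳ-sumK t a f rewrite sumK≡sum t f | sumK≡sum t (λ i → f i * a) = *-distribʳ-sum a f

  sumK-remove : ∀ t (i : Fin (suc t)) (f : Fin (suc t) → Carrier) → sumK K (suc t) f ≈ f i + sumK K t (f ∘ punchIn i)
  sumK-remove t i f rewrite sumK≡sum (suc t) f | sumK≡sum t (f ∘ punchIn i) = sum-remove f

  sumK-single : ∀ t (i : Fin t) (f : Fin t → Carrier) → (∀ j → j ≢ i → f j ≈ 0#) → sumK K t f ≈ f i
  sumK-single (suc t) i f f≈0 = trans (sumK-remove t i f)
    (trans (+-congˡ (sumK-zero t (λ j → f≈0 (punchIn i j) (punchInᵢ≢i i j)))) (+-identityʳ _))

  -‿sumK : ∀ t (f : Fin t → Carrier) → - sumK K t f ≈ sumK K t (λ i → - f i)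
  -‿sumK zero    f = -0#≈0#
  -‿sumK (suc t) f = trans (sym (-‿+-comm _ _)) (+-congˡ (-‿sumK t (f ∘ Fin.suc)))

  sumK-distrib-- : ∀ t (f g : Fin t → Carrier) → sumK K t (λ i → f i - g i) ≈ sumK K t f - sumK K t g
  sumK-distrib-- t f g = trans (sumK-distrib-+ t f (λ i → - g i)) (+-congˡ (sym (-‿sumK t g)))

module FieldHomProperties {F K : Field} (h : FieldHom F K) where
  private module F = Field F
  open Field K
  open FieldHom h
  open RingProperties ring using (+-identityʳ-unique; +-inverseʳ-unique)
  open SetoidReasoning setoid

  ⟦0⟧≈0 : ⟦ F.0# ⟧ ≈ 0#
  ⟦0⟧≈0 = +-identityʳ-unique _ _ (trans (sym (hom-+ F.0# F.0#)) (cong (F.+-identityˡ F.0#)))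

  ⟦-x⟧≈-⟦x⟧ : ∀ x → ⟦ F.- x ⟧ ≈ - ⟦ x ⟧
  ⟦-x⟧≈-⟦x⟧ x = +-inverseʳ-unique _ _ (trans (sym (hom-+ x (F.- x))) (trans (cong (F.-‿inverseʳ x)) ⟦0⟧≈0))

  ⟦x-y⟧≈⟦x⟧-⟦y⟧ : ∀ x y → ⟦ x F.- y ⟧ ≈ ⟦ x ⟧ - ⟦ y ⟧
  ⟦x-y⟧≈⟦x⟧-⟦y⟧ x y = trans (hom-+ x (F.- y)) (+-congˡ (⟦-x⟧≈-⟦x⟧ y))

  ⟦sumK⟧≈sumK⟦⟧ : ∀ t (f : Fin t → F.Carrier) → ⟦ sumK F t f ⟧ ≈ sumK K t (⟦_⟧ ∘ f)
  ⟦sumK⟧≈sumK⟦⟧ zero    f = ⟦0⟧≈0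
  ⟦sumK⟧≈sumK⟦⟧ (suc t) f = trans (hom-+ _ _) (+-congˡ (⟦sumK⟧≈sumK⟦⟧ t (f ∘ Fin.suc)))

  ⟦_⟧ᵛ : ∀ {k} → Vect F k → Vect K k
  ⟦ u ⟧ᵛ i = ⟦ u i ⟧

  ⟦lincomb⟧≈lincomb⟦⟧ : ∀ {k} t (c : Fin t → F.Carrier) (w : Fin t → Vect F k) →
    EqV K ⟦ lincomb F t c w ⟧ᵛ (lincomb K t (⟦_⟧ ∘ c) (⟦_⟧ᵛ ∘ w))
  ⟦lincomb⟧≈lincomb⟦⟧ t c w m = trans (⟦sumK⟧≈sumK⟦⟧ t _) (FiniteSums.sumK-cong K t (λ i → hom-* _ _))

  module _ (_≟_ : Decidable F._≈_) where

    ⟦x⟧≈0⇒x≈0 : ∀ {x} → ⟦ x ⟧ ≈ 0# → x F.≈ F.0#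
    ⟦x⟧≈0⇒x≈0 {x} ⟦x⟧≈0 with x ≟ F.0#
    ... | yes x≈0 = x≈0
    ... | no x≉0 with F.inverse x x≉0
    ...   | y , xy≈1 = contradiction (begin
            0#            ≈⟨ zeroˡ ⟦ y ⟧ ⟨
            0# * ⟦ y ⟧    ≈⟨ *-congʳ ⟦x⟧≈0 ⟨
            ⟦ x ⟧ * ⟦ y ⟧ ≈⟨ hom-* x y ⟨
            ⟦ x F.* y ⟧   ≈⟨ cong xy≈1 ⟩
            ⟦ F.1# ⟧      ≈⟨ hom-1 ⟩
            1#            ∎) 0≉1

    ⟦u⟧ᵛ≈0⇒u≈0 : ∀ {k} {u : Vect F k} → EqV K ⟦ u ⟧ᵛ (0v K) → EqV F u (0v F)
    ⟦u⟧ᵛ≈0⇒u≈0 ⟦u⟧≈0 i = ⟦x⟧≈0⇒x≈0 (⟦u⟧≈0 i)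

record Enumeration (S : Setoid 0ℓ 0ℓ) (n : ℕ) : Set where
  open Setoid S
  field
    enum            : Fin n → Carrier
    enum-injective  : ∀ i j → enum i ≈ enum j → i ≡ j
    enum-surjective : ∀ x → ∃ λ i → enum i ≈ x

  index : Carrier → Fin n
  index x = proj₁ (enum-surjective x)

  enum-index : ∀ x → enum (index x) ≈ x
  enum-index x = proj₂ (enum-surjective x)

  index-injective : ∀ {x y} → index x ≡ index y → x ≈ y
  index-injective {x} {y} eq = trans (sym (enum-index x)) (trans (reflexive (≡.cong enum eq)) (enum-index y))

  _≟_ : Decidable _≈_
  x ≟ y with index x Fin.≟ index y
  ... | yes eq = yes (index-injective eq)
  ... | no neq = no λ x≈y → neq (enum-injective _ _ (trans (enum-index x) (trans x≈y (sym (enum-index y)))))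

  ∃? : {P : Carrier → Set} → (∀ {x y} → x ≈ y → P x → P y) → (∀ x → Dec (P x)) → Dec (∃ P)
  ∃? resp P? with any? (λ i → P? (enum i))
  ... | yes (i , p) = yes (enum i , p)
  ... | no ¬p = no λ (x , px) → ¬p (index x , resp (sym (enum-index x)) px)

module _ {S T : Setoid 0ℓ 0ℓ} {a b : ℕ} (EnumS : Enumeration S a) (EnumT : Enumeration T b)
         (f : Setoid.Carrier S → Setoid.Carrier T) where
  private
    module S = Setoid S
    module T = Setoid T
    module ES = Enumeration EnumS
    module ET = Enumeration EnumT

    f̂ : Fin a → Fin b
    f̂ i = ET.index (f (ES.enum i))

  injection⇒≤ : (∀ x y → f x T.≈ f y → x S.≈ y) → a ≤ b
  injection⇒≤ f-inj = injective⇒≤ {f = f̂} λ {i} {j} eq → ES.enum-injective i j (f-inj _ _ (ET.index-injective eq))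

  >⇒collision : b < a → ∃ λ x → ∃ λ y → f x T.≈ f y × ¬ x S.≈ y
  >⇒collision b<a with pigeonhole b<a f̂
  ... | i , j , i<j , eq = ES.enum i , ES.enum j , ET.index-injective eq , λ eij → <⇒≢ i<j (ES.enum-injective i j eij)

funToFin-cong : ∀ {m n} {f g : Fin m → Fin n} → f ≗ g → funToFin f ≡ funToFin g
funToFin-cong {zero}  f≗g = ≡.refl
funToFin-cong {suc m} f≗g = ≡.cong₂ Fin.combine (f≗g Fin.zero) (funToFin-cong (f≗g ∘ Fin.suc))

vectorEnumeration : ∀ {S : Setoid 0ℓ 0ℓ} {N} → Enumeration S N → ∀ t → Enumeration (≋-setoid S t) (N ^ t)
vectorEnumeration {S} {N} E t = record
  { enum            = λ i l → enum (finToFun {N} {t} i l)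
  ; enum-injective  = λ i j eq → begin
      i                             ≡⟨ funToFin-finToFin {t} {N} i ⟨
      funToFin (finToFun {N} {t} i) ≡⟨ funToFin-cong (λ l → enum-injective _ _ (eq l)) ⟩
      funToFin (finToFun {N} {t} j) ≡⟨ funToFin-finToFin {t} {N} j ⟩
      j                             ∎
  ; enum-surjective = λ x → funToFin (index ∘ x) , λ l →
      Setoid.trans S (Setoid.reflexive S (≡.cong enum (finToFun-funToFin (index ∘ x) l))) (enum-index (x l))
  }
  where open Enumeration E
        open ≡.≡-Reasoning

fieldEnumeration : ∀ (F : Field) {N} → HasSize F N → Enumeration (Field.setoid F) N
fieldEnumeration F (e , e-inj , e-surj) = record { enum = e ; enum-injective = e-inj ; enum-surjective = e-surj }

enumeratedField⇒2≤ : ∀ {F N} → Enumeration (Field.setoid F) N → 2 ≤ N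
enumeratedField⇒2≤ {F} E = injective⇒≤ {f = f} f-inj
  where
  open Enumeration E
  f : Fin 2 → Fin _
  f Fin.zero    = index (Field.0# F)
  f (Fin.suc _) = index (Field.1# F)
  f-inj : ∀ {i j} → f i ≡ f j → i ≡ j
  f-inj {Fin.zero}          {Fin.zero}          _  = ≡.refl
  f-inj {Fin.zero}          {Fin.suc Fin.zero}  eq = contradiction (index-injective eq) (Field.0≉1 F)
  f-inj {Fin.suc Fin.zero}  {Fin.zero}          eq = contradiction (Field.sym F (index-injective eq)) (Field.0≉1 F)
  f-inj {Fin.suc Fin.zero}  {Fin.suc Fin.zero}  _  = ≡.refl

^-cancelʳ-≤ : ∀ N {a b} → 2 ≤ N → N ^ a ≤ N ^ b → a ≤ b
^-cancelʳ-≤ N {a} {b} 2≤N Nᵃ≤Nᵇ with a ℕ.≤? b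
... | yes a≤b = a≤b
... | no a≰b  = contradiction Nᵃ≤Nᵇ (ℕ.<⇒≱ (ℕ.^-monoʳ-< N 2≤N (ℕ.≰⇒> a≰b)))

idₕ : (K : Field) → FieldHom K K
idₕ K = record
  { ⟦_⟧ = λ x → x ; cong = λ x≈y → x≈y ; hom-+ = λ _ _ → Field.refl K ; hom-* = λ _ _ → Field.refl K ; hom-1 = Field.refl K }

δ : (F : Field) {n : ℕ} → Fin n → Fin n → Field.Carrier F
δ F i j with i Fin.≟ j
... | yes _ = Field.1# F
... | no  _ = Field.0# F

δ-diag : (F : Field) {n : ℕ} (i : Fin n) → Field._≈_ F (δ F i i) (Field.1# F)
δ-diag F i with i Fin.≟ i
... | yes _  = Field.refl F
... | no i≢i = contradiction ≡.refl i≢i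

δ-off : (F : Field) {n : ℕ} {i j : Fin n} → i ≢ j → Field._≈_ F (δ F i j) (Field.0# F)
δ-off F {i = i} {j = j} i≢j with i Fin.≟ j
... | yes i≡j = contradiction i≡j i≢j
... | no  _   = Field.refl F

module KroneckerSums {F K : Field} (h : FieldHom F K) where
  open Field K
  open FieldHom h
  open FieldHomProperties h
  open FiniteSums K

  sumK-⟦δ⟧* : ∀ n (x : Fin n → Carrier) i → sumK K n (λ l → ⟦ δ F i l ⟧ * x l) ≈ x i
  sumK-⟦δ⟧* n x i = trans (sumK-single n i _ (λ l l≢i → trans (*-congʳ (trans (cong (δ-off F (l≢i ∘ ≡.sym))) ⟦0⟧≈0)) (zeroˡ _)))
                          (trans (*-congʳ (trans (cong (δ-diag F i)) hom-1)) (*-identityˡ _))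

  sumK-*⟦δ⟧ : ∀ n (x : Fin n → Carrier) i → sumK K n (λ l → x l * ⟦ δ F l i ⟧) ≈ x i
  sumK-*⟦δ⟧ n x i = trans (sumK-single n i _ (λ l l≢i → trans (*-congˡ (trans (cong (δ-off F l≢i)) ⟦0⟧≈0)) (zeroʳ _)))
                          (trans (*-congˡ (trans (cong (δ-diag F i)) hom-1)) (*-identityʳ _))

module SubfieldSpan {F K : Field} (h : FieldHom F K) (k : ℕ) where
  private
    module F = Field F
    module FR = RingProperties F.ring
  open Field K
  open FieldHom h
  open FieldHomProperties h
  open KroneckerSums h
  open FiniteSums K
  open RingProperties ring using ([y-z]x≈yx-zx; x∙y⁻¹≈ε⇒x≈y; x≈y⇒x∙y⁻¹≈ε)
  open SetoidReasoning setoid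

  V : Set
  V = Vect K k

  infix 4 _≈ᵥ_
  _≈ᵥ_ : V → V → Set
  _≈ᵥ_ = EqV K

  open Setoid (≋-setoid setoid k) using () renaming (sym to ≈ᵥ-sym; trans to ≈ᵥ-trans)

  lincombₕ : ∀ t → (Fin t → F.Carrier) → (Fin t → V) → V
  lincombₕ t c w = lincomb K t (⟦_⟧ ∘ c) w

  Independent : ∀ t → (Fin t → V) → Set
  Independent t w = ∀ c → lincombₕ t c w ≈ᵥ 0v K → ∀ i → c i F.≈ F.0#

  InSpanₕ : ∀ t → (Fin t → V) → V → Set
  InSpanₕ t w v = ∃ λ c → v ≈ᵥ lincombₕ t c w

  InSetSpanₕ : (V → Set) → V → Set
  InSetSpanₕ S v = ∃ λ t → ∃ λ (w : Fin t → V) → (∀ i → S (w i)) × InSpanₕ t w v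

  lincombₕ-cong : ∀ t (w : Fin t → V) {c c' : Fin t → F.Carrier} → (∀ i → c i F.≈ c' i) → lincombₕ t c w ≈ᵥ lincombₕ t c' w
  lincombₕ-cong t w c≈c' m = sumK-cong t (λ i → *-congʳ (cong (c≈c' i)))

  lincombₕ-δ : ∀ t (w : Fin t → V) i → lincombₕ t (δ F i) w ≈ᵥ w i
  lincombₕ-δ t w i m = sumK-⟦δ⟧* t (λ l → w l m) i

  lincombₕ-- : ∀ t (c c' : Fin t → F.Carrier) (w : Fin t → V) →
    lincombₕ t (λ i → c i F.- c' i) w ≈ᵥ (λ m → lincombₕ t c w m - lincombₕ t c' w m)
  lincombₕ-- t c c' w m =
    trans (sumK-cong t (λ i → trans (*-congʳ (⟦x-y⟧≈⟦x⟧-⟦y⟧ _ _)) ([y-z]x≈yx-zx _ _ _))) (sumK-distrib-- t _ _)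

  lincombₕ-compose : ∀ a b (w : Fin a → V) (u : Fin b → V) (d : Fin a → Fin b → F.Carrier) →
    (∀ s → w s ≈ᵥ lincombₕ b (d s) u) → ∀ c →
    lincombₕ a c w ≈ᵥ lincombₕ b (λ i → sumK F a (λ s → c s F.* d s i)) u
  lincombₕ-compose a b w u d w≈du c m = begin
    sumK K a (λ s → ⟦ c s ⟧ * w s m)                               ≈⟨ sumK-cong a (λ s → *-congˡ (w≈du s m)) ⟩
    sumK K a (λ s → ⟦ c s ⟧ * sumK K b (λ i → ⟦ d s i ⟧ * u i m))   ≈⟨ sumK-cong a (λ s → *-distribˡ-sumK b _ _) ⟩
    sumK K a (λ s → sumK K b (λ i → ⟦ c s ⟧ * (⟦ d s i ⟧ * u i m))) ≈⟨ sumK-comm a b _ ⟩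
    sumK K b (λ i → sumK K a (λ s → ⟦ c s ⟧ * (⟦ d s i ⟧ * u i m))) ≈⟨ sumK-cong b (λ i → sumK-cong a (λ s →
                                                                       trans (sym (*-assoc _ _ _)) (*-congʳ (sym (hom-* _ _))))) ⟩
    sumK K b (λ i → sumK K a (λ s → ⟦ c s F.* d s i ⟧ * u i m))     ≈⟨ sumK-cong b (λ i → sym (*-distribʳ-sumK a _ _)) ⟩
    sumK K b (λ i → sumK K a (λ s → ⟦ c s F.* d s i ⟧) * u i m)     ≈⟨ sumK-cong b (λ i → *-congʳ (sym (⟦sumK⟧≈sumK⟦⟧ a _))) ⟩
    sumK K b (λ i → ⟦ sumK F a (λ s → c s F.* d s i) ⟧ * u i m)     ∎

  InSpanₕ-trans : ∀ {a b} {w : Fin a → V} {u : Fin b → V} → (∀ s → InSpanₕ b u (w s)) → ∀ {v} → InSpanₕ a w v → InSpanₕ b u v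
  InSpanₕ-trans {a} {b} {w} {u} w∈⟨u⟩ (c , v≈cw) =
    _ , ≈ᵥ-trans v≈cw (lincombₕ-compose a b w u (proj₁ ∘ w∈⟨u⟩) (proj₂ ∘ w∈⟨u⟩) c)

  Independent⇒lincombₕ-injective : ∀ {t} {w : Fin t → V} → Independent t w →
    ∀ c c' → lincombₕ t c w ≈ᵥ lincombₕ t c' w → ∀ i → c i F.≈ c' i
  Independent⇒lincombₕ-injective {t} {w} ind c c' cw≈c'w i =
    FR.x∙y⁻¹≈ε⇒x≈y _ _ (ind _ (λ m → trans (lincombₕ-- t c c' w m) (x≈y⇒x∙y⁻¹≈ε (cw≈c'w m))) i)

  Independent⇒≉0 : ∀ {t} {w : Fin t → V} → Independent t w → ∀ i → ¬ w i ≈ᵥ 0v K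
  Independent⇒≉0 {t} {w} ind i wᵢ≈0 =
    F.0≉1 (F.trans (F.sym (ind (δ F i) (≈ᵥ-trans (lincombₕ-δ t w i) wᵢ≈0) i)) (δ-diag F i))

  *-lincombₕ : ∀ t a (c : Fin t → F.Carrier) (w : Fin t → V) →
    (λ m → ⟦ a ⟧ * lincombₕ t c w m) ≈ᵥ lincombₕ t (λ i → a F.* c i) w
  *-lincombₕ t a c w m =
    trans (*-distribˡ-sumK t _ _) (sumK-cong t (λ i → trans (sym (*-assoc _ _ _)) (*-congʳ (sym (hom-* _ _)))))

  InSpanₕ-∷ʳ : ∀ {t} {g : Fin t → V} v {x} → InSpanₕ t g x → InSpanₕ (suc t) (v ∷ g) x
  InSpanₕ-∷ʳ v (c , x≈cg) =
    F.0# ∷ c , λ m → trans (x≈cg m) (sym (trans (+-congʳ (trans (*-congʳ ⟦0⟧≈0) (zeroˡ _))) (+-identityˡ _)))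

  InSpanₕ-∷-head : ∀ {t} (g : Fin t → V) v → InSpanₕ (suc t) (v ∷ g) v
  InSpanₕ-∷-head {t} g v = δ F Fin.zero , ≈ᵥ-sym (lincombₕ-δ (suc t) (v ∷ g) Fin.zero)

  InSpanₕ-pad : ∀ {P : V → Set} {t s} → t ≤ s → (w : Fin t → V) → (∀ i → P (w i)) →
    ∀ {v} → ¬ v ≈ᵥ 0v K → InSpanₕ t w v → ∃ λ (u : Fin s → V) → (∀ i → P (u i)) × InSpanₕ s u v
  InSpanₕ-pad {P} {zero}          _   w _   v≉0 (_ , v≈0) = contradiction v≈0 v≉0
  InSpanₕ-pad {P} {suc t} {s} t≤s w w∈P {v} v≉0 v∈⟨w⟩ =
    ≡.subst (λ s → ∃ λ (u : Fin s → V) → (∀ i → P (u i)) × InSpanₕ s u v) (ℕ.m∸n+n≡m t≤s) (padBy (s ∸ suc t))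
    where
    padBy : ∀ p → ∃ λ (u : Fin (p ℕ.+ suc t) → V) → (∀ i → P (u i)) × InSpanₕ (p ℕ.+ suc t) u v
    padBy zero    = w , w∈P , v∈⟨w⟩
    padBy (suc p) with padBy p
    ... | u , u∈P , v∈⟨u⟩ = w Fin.zero ∷ u , (λ { Fin.zero → w∈P Fin.zero ; (Fin.suc i) → u∈P i }) , InSpanₕ-∷ʳ _ v∈⟨u⟩

  module _ (_≟_ : Decidable F._≈_) where

    Independent-∷ : ∀ {t} {g : Fin t → V} {v} → Independent t g → ¬ InSpanₕ t g v → Independent (suc t) (v ∷ g)
    Independent-∷ {t} {g} {v} ind v∉⟨g⟩ c c[v∷g]≈0 with c Fin.zero ≟ F.0#
    ... | yes c₀≈0 = λ { Fin.zero → c₀≈0 ; (Fin.suc i) → ind (c ∘ Fin.suc) tail≈0 i }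
      where
      tail≈0 : lincombₕ t (c ∘ Fin.suc) g ≈ᵥ 0v K
      tail≈0 m = trans (sym (trans (+-congʳ (trans (*-congʳ (trans (cong c₀≈0) ⟦0⟧≈0)) (zeroˡ _))) (+-identityˡ _)))
                       (c[v∷g]≈0 m)
    ... | no c₀≉0 with F.inverse (c Fin.zero) c₀≉0
    ...   | y , c₀y≈1 = contradiction (_ , v≈) v∉⟨g⟩
      where
      open RingProperties ring using (+-inverseˡ-unique; -‿distribˡ-*; -‿distribʳ-*)
      L : V
      L = lincombₕ t (c ∘ Fin.suc) g
      ⟦y⟧⟦c₀⟧≈1 : ⟦ y ⟧ * ⟦ c Fin.zero ⟧ ≈ 1#
      ⟦y⟧⟦c₀⟧≈1 = trans (sym (hom-* _ _)) (trans (cong (F.*-comm y _)) (trans (cong c₀y≈1) hom-1))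
      v≈ : v ≈ᵥ lincombₕ t (λ i → (F.- y) F.* c (Fin.suc i)) g
      v≈ m = begin
        v m                              ≈⟨ *-identityˡ _ ⟨
        1# * v m                         ≈⟨ *-congʳ ⟦y⟧⟦c₀⟧≈1 ⟨
        (⟦ y ⟧ * ⟦ c Fin.zero ⟧) * v m   ≈⟨ *-assoc _ _ _ ⟩
        ⟦ y ⟧ * (⟦ c Fin.zero ⟧ * v m)   ≈⟨ *-congˡ (+-inverseˡ-unique _ _ (c[v∷g]≈0 m)) ⟩
        ⟦ y ⟧ * - L m                    ≈⟨ -‿distribʳ-* _ _ ⟨
        - (⟦ y ⟧ * L m)                  ≈⟨ -‿distribˡ-* _ _ ⟩
        - ⟦ y ⟧ * L m                    ≈⟨ *-congʳ (⟦-x⟧≈-⟦x⟧ y) ⟨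
        ⟦ F.- y ⟧ * L m                  ≈⟨ *-lincombₕ t (F.- y) (c ∘ Fin.suc) g m ⟩
        lincombₕ t (λ i → (F.- y) F.* c (Fin.suc i)) g m ∎

  record IndependentFamily (S : V → Set) : Set where
    field
      size        : ℕ
      family      : Fin size → V
      independent : Independent size family
      family∈S    : ∀ i → S (family i)

  open IndependentFamily public

  infix 4 _∈⟨_⟩
  _∈⟨_⟩ : ∀ {S} → V → IndependentFamily S → Set
  v ∈⟨ g ⟩ = InSpanₕ (size g) (family g) v

  module Finite {N : ℕ} (EnumF : Enumeration F.setoid N) (_≟_ : Decidable _≈_) where

    InSpanₕ? : ∀ t (w : Fin t → V) v → Dec (InSpanₕ t w v)
    InSpanₕ? t w v = Enumeration.∃? (vectorEnumeration EnumF t)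
      (λ c≈c' v≈cw → ≈ᵥ-trans v≈cw (lincombₕ-cong t w c≈c'))
      (λ c → all? (λ m → v m ≟ lincombₕ t c w m))

    module _ {S : V → Set} where
      private
        _⊑_ : IndependentFamily S → IndependentFamily S → Set
        g ⊑ g' = ∀ {v} → v ∈⟨ g ⟩ → v ∈⟨ g' ⟩

        insert : ∀ g v → S v → ∃ λ g' → g ⊑ g' × v ∈⟨ g' ⟩
        insert g v v∈S with InSpanₕ? (size g) (family g) v
        ... | yes v∈⟨g⟩ = g , (λ x∈⟨g⟩ → x∈⟨g⟩) , v∈⟨g⟩
        ... | no  v∉⟨g⟩ = record
          { size        = suc (size g)
          ; family      = v ∷ family g
          ; independent = Independent-∷ (Enumeration._≟_ EnumF) (independent g) v∉⟨g⟩
          ; family∈S    = λ { Fin.zero → v∈S ; (Fin.suc i) → family∈S g i }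
          } , InSpanₕ-∷ʳ v , InSpanₕ-∷-head (family g) v

        insertAll : ∀ g {T} (f : Fin T → V) → (∀ i → S (f i)) → ∃ λ g' → g ⊑ g' × (∀ i → f i ∈⟨ g' ⟩)
        insertAll g {zero}  f _   = g , (λ x∈⟨g⟩ → x∈⟨g⟩) , λ ()
        insertAll g {suc T} f f∈S with insert g (f Fin.zero) (f∈S Fin.zero)
        ... | g₁ , g⊑g₁ , f₀∈⟨g₁⟩ with insertAll g₁ (f ∘ Fin.suc) (f∈S ∘ Fin.suc)
        ...   | g₂ , g₁⊑g₂ , f₊∈⟨g₂⟩ =
          g₂ , (λ x∈⟨g⟩ → g₁⊑g₂ (g⊑g₁ x∈⟨g⟩)) , λ { Fin.zero → g₁⊑g₂ f₀∈⟨g₁⟩ ; (Fin.suc i) → f₊∈⟨g₂⟩ i }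

        extendToSpan : ∀ g {M} (x : Fin M → V) → (∀ t → InSetSpanₕ S (x t)) → ∃ λ g' → g ⊑ g' × (∀ t → x t ∈⟨ g' ⟩)
        extendToSpan g {zero}  x _ = g , (λ x∈⟨g⟩ → x∈⟨g⟩) , λ ()
        extendToSpan g {suc M} x x∈⟨S⟩ with x∈⟨S⟩ Fin.zero
        ... | _ , f , f∈S , x₀∈⟨f⟩ with insertAll g f f∈S
        ...   | g₁ , g⊑g₁ , f∈⟨g₁⟩ with extendToSpan g₁ (x ∘ Fin.suc) (x∈⟨S⟩ ∘ Fin.suc)
        ...     | g₂ , g₁⊑g₂ , x₊∈⟨g₂⟩ = g₂ , (λ y∈⟨g⟩ → g₁⊑g₂ (g⊑g₁ y∈⟨g⟩)) ,
                  λ { Fin.zero → g₁⊑g₂ (InSpanₕ-trans f∈⟨g₁⟩ x₀∈⟨f⟩) ; (Fin.suc t) → x₊∈⟨g₂⟩ t }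

        empty : IndependentFamily S
        empty = record { size = 0 ; family = λ () ; independent = λ _ _ () ; family∈S = λ () }

      independentSpanningFamily : ∀ {M} (x : Fin M → V) → (∀ t → InSetSpanₕ S (x t)) →
        ∃ λ (g : IndependentFamily S) → ∀ t → x t ∈⟨ g ⟩
      independentSpanningFamily x x∈⟨S⟩ with g , _ , x∈⟨g⟩ ← extendToSpan empty x x∈⟨S⟩ = g , x∈⟨g⟩

    independent-in-span⇒≤ : ∀ {a b} {w : Fin a → V} {u : Fin b → V} → Independent a w → (∀ s → InSpanₕ b u (w s)) → a ≤ b
    independent-in-span⇒≤ {a} {b} {w} {u} ind w∈⟨u⟩ =
      ^-cancelʳ-≤ N (enumeratedField⇒2≤ {F} EnumF) (injection⇒≤ (vectorEnumeration EnumF a) (vectorEnumeration EnumF b) coords coords-inj)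
      where
      d : Fin a → Fin b → F.Carrier
      d = proj₁ ∘ w∈⟨u⟩
      coords : (Fin a → F.Carrier) → Fin b → F.Carrier
      coords c i = sumK F a (λ s → c s F.* d s i)
      compose : ∀ c → lincombₕ a c w ≈ᵥ lincombₕ b (coords c) u
      compose = lincombₕ-compose a b w u d (proj₂ ∘ w∈⟨u⟩)
      coords-inj : ∀ c c' → (∀ i → coords c i F.≈ coords c' i) → ∀ s → c s F.≈ c' s
      coords-inj c c' eq = Independent⇒lincombₕ-injective ind c c'
        (≈ᵥ-trans (compose c) (≈ᵥ-trans (lincombₕ-cong b u eq) (≈ᵥ-sym (compose c'))))

module _ {F K : Field} (h : FieldHom F K) where
  private module F = Field F
  open Field K
  open FieldHom h

  record Basis (d : ℕ) : Set where
    field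
      ξ                  : Fin d → Carrier
      coordinates        : ∀ (x : Carrier) → ∃ λ (c : Fin d → F.Carrier) → x ≈ sumK K d (λ t → ⟦ c t ⟧ * ξ t)
      coordinates-unique : ∀ (c c' : Fin d → F.Carrier) → sumK K d (λ t → ⟦ c t ⟧ * ξ t) ≈ sumK K d (λ t → ⟦ c' t ⟧ * ξ t) →
                           ∀ t → c t F.≈ c' t

  module _ {d : ℕ} (B : Basis d) where
    open Basis B
    open FieldHomProperties h
    open KroneckerSums h

    ξ≉0 : ∀ t → ¬ ξ t ≈ 0#
    ξ≉0 t ξₜ≈0 = F.0≉1 (F.sym (F.trans (F.sym (δ-diag F t)) (coordinates-unique (δ F t) (λ _ → F.0#) δξ≈0ξ t)))
      where
      δξ≈0ξ : sumK K d (λ s → ⟦ δ F t s ⟧ * ξ s) ≈ sumK K d (λ s → ⟦ F.0# ⟧ * ξ s)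
      δξ≈0ξ = trans (sumK-⟦δ⟧* d ξ t) (trans ξₜ≈0 (sym (FiniteSums.sumK-zero K d (λ s → trans (*-congʳ ⟦0⟧≈0) (zeroˡ _)))))

  module _ {N d : ℕ} (EnumF : Enumeration F.setoid N) (EnumK : Enumeration setoid (N ^ d)) where
    -- K is regarded as the F-space K¹.
    open SubfieldSpan h 1
    open Finite EnumF (Enumeration._≟_ EnumK)
    open Enumeration EnumK using (enum; enum-index)

    private
      scalar : Carrier → V
      scalar x _ = x

      Everything : V → Set
      Everything _ = ⊤

      spanning : ∃ λ (g : IndependentFamily Everything) → ∀ i → scalar (enum i) ∈⟨ g ⟩
      spanning = independentSpanningFamily (scalar ∘ enum)
        (λ i → 1 , scalar (enum i) ∷ (λ ()) , (λ _ → tt) , InSpanₕ-∷-head (λ ()) (scalar (enum i)))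

      g : IndependentFamily Everything
      g = proj₁ spanning

      r : ℕ
      r = size g

      everything∈⟨g⟩ : ∀ x → scalar x ∈⟨ g ⟩
      everything∈⟨g⟩ x with proj₂ spanning (Enumeration.index EnumK x)
      ... | c , eq = c , λ m → trans (sym (enum-index x)) (eq m)

      coords : Carrier → Fin r → F.Carrier
      coords x = proj₁ (everything∈⟨g⟩ x)

      basisOfSize-r : Basis r
      basisOfSize-r = record
        { ξ                  = λ t → family g t Fin.zero
        ; coordinates        = λ x → coords x , proj₂ (everything∈⟨g⟩ x) Fin.zero
        ; coordinates-unique = λ c c' eq → Independent⇒lincombₕ-injective (independent g) c c' (λ { Fin.zero → eq })
        }

      r≤d : r ≤ d
      r≤d = ^-cancelʳ-≤ N (enumeratedField⇒2≤ {F} EnumF) (injection⇒≤ (vectorEnumeration EnumF r) EnumK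
        (λ c → lincombₕ r c (family g) Fin.zero)
        (λ c c' eq → Independent⇒lincombₕ-injective (independent g) c c' (λ { Fin.zero → eq })))

      d≤r : d ≤ r
      d≤r = ^-cancelʳ-≤ N (enumeratedField⇒2≤ {F} EnumF) (injection⇒≤ EnumK (vectorEnumeration EnumF r) coords
        (λ x y eq → trans (proj₂ (everything∈⟨g⟩ x) Fin.zero)
                   (trans (lincombₕ-cong r (family g) eq Fin.zero) (sym (proj₂ (everything∈⟨g⟩ y) Fin.zero)))))

    basisOfSize : Basis d
    basisOfSize = ≡.subst Basis (ℕ.≤-antisym r≤d d≤r) basisOfSize-r

module Hyperplanes (F : Field) {N : ℕ} (EnumF : Enumeration (Field.setoid F) N) where
  open Field F
  open FiniteSums F
  open RingProperties ring using ([y-z]x≈yx-zx; x∙y⁻¹≈ε⇒x≈y; x≈y⇒x∙y⁻¹≈ε)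
  open SetoidReasoning setoid
  open Enumeration EnumF using (_≟_)

  -- Pigeonhole on the linear map a ↦ (a · w t)ₜ from Fᵏ to Fᵈ.
  hyperplaneThrough : ∀ {k d} → d < k → (w : Fin d → Vect F k) →
    ∃ λ a → ¬ EqV F a (0v F) × (∀ t → InHyperplane F a (w t))
  hyperplaneThrough {k} {d} d<k w
    with >⇒collision (vectorEnumeration EnumF k) (vectorEnumeration EnumF d)
           (λ a t → sumK F k (λ l → a l * w t l)) (ℕ.^-monoʳ-< N (enumeratedField⇒2≤ {F} EnumF) d<k)
  ... | a , a' , a·w≈a'·w , a≉a' =
    (λ l → a l - a' l) , (λ a-a'≈0 → a≉a' (λ l → x∙y⁻¹≈ε⇒x≈y _ _ (a-a'≈0 l))) ,
    λ t → trans (sumK-cong k (λ l → [y-z]x≈yx-zx _ _ _)) (trans (sumK-distrib-- k _ _) (x≈y⇒x∙y⁻¹≈ε (a·w≈a'·w t)))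

  module _ {k : ℕ} where
    open SubfieldSpan (idₕ F) k

    InHyperplane-lincomb : ∀ a {r} (g : Fin r → V) → (∀ s → InHyperplane F a (g s)) →
      ∀ c → InHyperplane F a (lincombₕ r c g)
    InHyperplane-lincomb a {r} g g⊆H c = begin
      sumK F k (λ l → a l * sumK F r (λ s → c s * g s l))   ≈⟨ sumK-cong k (λ l → *-distribˡ-sumK r (a l) _) ⟩
      sumK F k (λ l → sumK F r (λ s → a l * (c s * g s l))) ≈⟨ sumK-comm k r _ ⟩
      sumK F r (λ s → sumK F k (λ l → a l * (c s * g s l))) ≈⟨ sumK-cong r (λ s → sumK-cong k (λ l → x[yz]≈y[xz] (a l) (c s) (g s l))) ⟩
      sumK F r (λ s → sumK F k (λ l → c s * (a l * g s l))) ≈⟨ sumK-cong r (λ s → sym (*-distribˡ-sumK k (c s) _)) ⟩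
      sumK F r (λ s → c s * sumK F k (λ l → a l * g s l))   ≈⟨ sumK-zero r (λ s → trans (*-congˡ (g⊆H s)) (zeroʳ _)) ⟩
      0#                                                    ∎
      where
      x[yz]≈y[xz] : ∀ x y z → x * (y * z) ≈ y * (x * z)
      x[yz]≈y[xz] x y z = trans (sym (*-assoc x y z)) (trans (*-congʳ (*-comm x y)) (*-assoc y x z))

  module _ {k : ℕ} where
    open SubfieldSpan (idₕ F) (suc k)

    InHyperplane-vanishing : ∀ {a z : V} {i} → ¬ a i ≈ 0# → InHyperplane F a z → (∀ l → l ≢ i → z l ≈ 0#) → z ≈ᵥ 0v F
    InHyperplane-vanishing {a} {z} {i} aᵢ≉0 a·z≈0 z≈0-off l with l Fin.≟ i
    ... | no l≢i    = z≈0-off l l≢i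
    ... | yes ≡.refl with inverse (a i) aᵢ≉0
    ...   | b , aᵢb≈1 = begin
      z i             ≈⟨ *-identityˡ _ ⟨
      1# * z i        ≈⟨ *-congʳ (trans (*-comm _ _) aᵢb≈1) ⟨
      (b * a i) * z i ≈⟨ *-assoc _ _ _ ⟩
      b * (a i * z i) ≈⟨ *-congˡ aᵢzᵢ≈0 ⟩
      b * 0#          ≈⟨ zeroʳ b ⟩
      0#              ∎
      where
      aᵢzᵢ≈0 : a i * z i ≈ 0#
      aᵢzᵢ≈0 = trans (sym (sumK-single (suc k) i (λ l → a l * z l) (λ l l≢i → trans (*-congˡ (z≈0-off l l≢i)) (zeroʳ _))))
                     a·z≈0

    -- A vector of the hyperplane is determined by its coordinates off a position where a does not vanish.
    independent-in-hyperplane⇒≤ : ∀ {a : V} → ¬ a ≈ᵥ 0v F → ∀ {r} {g : Fin r → V} → Independent r g →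
      (∀ s → InHyperplane F a (g s)) → r ≤ k
    independent-in-hyperplane⇒≤ {a} a≉0 {r} {g} ind g⊆H with ¬∀⟶∃¬ (suc k) (λ l → a l ≈ 0#) (λ l → a l ≟ 0#) a≉0
    ... | i , aᵢ≉0 = ^-cancelʳ-≤ N (enumeratedField⇒2≤ {F} EnumF)
                       (injection⇒≤ (vectorEnumeration EnumF r) (vectorEnumeration EnumF k) drop-i drop-i-injective)
      where
      drop-i : (Fin r → Carrier) → Fin k → Carrier
      drop-i c l = lincombₕ r c g (punchIn i l)

      drop-i-injective : ∀ c c' → (∀ l → drop-i c l ≈ drop-i c' l) → ∀ s → c s ≈ c' s
      drop-i-injective c c' eq s =
        x∙y⁻¹≈ε⇒x≈y _ _ (ind _ (InHyperplane-vanishing {a = a} aᵢ≉0 (InHyperplane-lincomb a g g⊆H _) off-i) s)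
        where
        off-i : ∀ l → l ≢ i → lincombₕ r (λ s → c s - c' s) g l ≈ 0#
        off-i l l≢i = trans (lincombₕ-- r c c' g l) (x≈y⇒x∙y⁻¹≈ε
          (≡.subst (λ l' → lincombₕ r c g l' ≈ lincombₕ r c' g l')
                   (punchIn-punchOut (l≢i ∘ ≡.sym)) (eq (punchOut (l≢i ∘ ≡.sym)))))

module ExtensionOfScalars {F₀ F Q : Field} (ι : FieldHom F₀ F) (j : FieldHom F Q) {k : ℕ} (U : Vect F k → Set) where
  private
    module F = Field F
    module Fᵏ = SubfieldSpan (idₕ F) k
    module Qᵏ = SubfieldSpan (idₕ Q) k
  open Field Q
  open FieldHom j
  open FieldHomProperties j
  open KroneckerSums j

  ImageVec-isFSubspace : IsFSubspace ι k U → IsFSubspace (j ∘ₕ ι) k (ImageVec j U)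
  ImageVec-isFSubspace U-sub = record
    { resp     = λ v≈w (u , u∈U , v≈⟦u⟧) → u , u∈U , λ i → trans (sym (v≈w i)) (v≈⟦u⟧ i)
    ; zero∈    = 0v F , zero∈ , λ i → sym ⟦0⟧≈0
    ; +-closed = λ (u , u∈U , v≈⟦u⟧) (u' , u'∈U , v'≈⟦u'⟧) →
                   addV F u u' , +-closed u∈U u'∈U , λ i → trans (+-cong (v≈⟦u⟧ i) (v'≈⟦u'⟧ i)) (sym (hom-+ _ _))
    ; ·-closed = λ a (u , u∈U , v≈⟦u⟧) →
                   scaleV F (FieldHom.⟦ ι ⟧ a) u , ·-closed a u∈U , λ i → trans (*-congˡ (v≈⟦u⟧ i)) (sym (hom-* _ _))
    }
    where open IsFSubspace U-sub

  ImageVec-hasFDim : Decidable F._≈_ → ∀ {n} → HasFDim ι k n U → HasFDim (j ∘ₕ ι) k n (ImageVec j U)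
  ImageVec-hasFDim _≟_ {n} (b , b∈U , b-independent , b-spans) =
    ⟦_⟧ᵛ ∘ b ,
    (λ i → b i , b∈U i , λ _ → refl) ,
    (λ a ⟦ab⟧≈0 → b-independent a (⟦u⟧ᵛ≈0⇒u≈0 _≟_ (λ m → trans (⟦lincomb⟧≈lincomb⟦⟧ n (FieldHom.⟦ ι ⟧ ∘ a) b m) (⟦ab⟧≈0 m)))) ,
    λ { v (u , u∈U , v≈⟦u⟧) → let (a , u≈ab) = b-spans u u∈U in
          a , λ m → trans (v≈⟦u⟧ m) (trans (cong (u≈ab m)) (⟦lincomb⟧≈lincomb⟦⟧ n (FieldHom.⟦ ι ⟧ ∘ a) b m)) }

  ImageVec-spans : ∀ {n} → HasFDim ι k n U → (∀ v → InSpan F U v) → ∀ v → InSpan Q (ImageVec j U) v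
  ImageVec-spans {n} (b , b∈U , _ , b-spans) U-spans v =
    n , ⟦_⟧ᵛ ∘ b , (λ i → b i , b∈U i , λ _ → refl) ,
    Qᵏ.InSpanₕ-trans ⟦e⟧∈⟨⟦b⟧⟩ (v , λ m → sym (sumK-*⟦δ⟧ k v m))
    where
    e : Fin k → Vect F k
    e = δ F

    U⊆⟨b⟩ : ∀ {u} → U u → Fᵏ.InSpanₕ n b u
    U⊆⟨b⟩ u∈U with b-spans _ u∈U
    ... | a , u≈ab = FieldHom.⟦ ι ⟧ ∘ a , u≈ab

    e∈⟨b⟩ : ∀ l → Fᵏ.InSpanₕ n b (e l)
    e∈⟨b⟩ l with U-spans (e l)
    ... | _ , w , w∈U , eₗ∈⟨w⟩ = Fᵏ.InSpanₕ-trans (U⊆⟨b⟩ ∘ w∈U) eₗ∈⟨w⟩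

    ⟦e⟧∈⟨⟦b⟧⟩ : ∀ l → Qᵏ.InSpanₕ n (⟦_⟧ᵛ ∘ b) ⟦ e l ⟧ᵛ
    ⟦e⟧∈⟨⟦b⟧⟩ l with e∈⟨b⟩ l
    ... | c , eₗ≈cb = ⟦_⟧ ∘ c , λ m → trans (cong (eₗ≈cb m)) (⟦lincomb⟧≈lincomb⟦⟧ n c b m)

  ImageVec-isSystem : Decidable F._≈_ → ∀ {n} → IsSystem ι n k U → IsSystem (j ∘ₕ ι) n k (ImageVec j U)
  ImageVec-isSystem _≟_ (U-sub , U-dim , U-spans) =
    ImageVec-isFSubspace U-sub , ImageVec-hasFDim _≟_ U-dim , ImageVec-spans U-dim U-spans

module Saturation {F Q : Field} (j : FieldHom F Q) {N : ℕ} (EnumF : Enumeration (Field.setoid F) N)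
                  {d : ℕ} (B : Basis j d) where
  private module F = Field F
  open Field Q
  open FieldHom j
  open FieldHomProperties j
  open KroneckerSums j
  open FiniteSums Q
  open Basis B
  open Hyperplanes F EnumF
  open SetoidReasoning setoid

  basis-expansion : ∀ {k} r (D : Fin r → Fin d → F.Carrier) (u : Fin r → Vect F k) →
    EqV Q (lincomb Q r (λ i → sumK Q d (λ t → ⟦ D i t ⟧ * ξ t)) (⟦_⟧ᵛ ∘ u))
          (λ m → sumK Q d (λ t → ⟦ lincomb F r (λ i → D i t) u m ⟧ * ξ t))
  basis-expansion r D u m = begin
    sumK Q r (λ i → sumK Q d (λ t → ⟦ D i t ⟧ * ξ t) * ⟦ u i m ⟧)   ≈⟨ sumK-cong r (λ i → *-distribʳ-sumK d _ _) ⟩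
    sumK Q r (λ i → sumK Q d (λ t → (⟦ D i t ⟧ * ξ t) * ⟦ u i m ⟧)) ≈⟨ sumK-comm r d _ ⟩
    sumK Q d (λ t → sumK Q r (λ i → (⟦ D i t ⟧ * ξ t) * ⟦ u i m ⟧)) ≈⟨ sumK-cong d (λ t → sumK-cong r (λ i → xy·z≈xz·y _ _ _)) ⟩
    sumK Q d (λ t → sumK Q r (λ i → (⟦ D i t ⟧ * ⟦ u i m ⟧) * ξ t)) ≈⟨ sumK-cong d (λ t → sym (*-distribʳ-sumK r _ _)) ⟩
    sumK Q d (λ t → sumK Q r (λ i → ⟦ D i t ⟧ * ⟦ u i m ⟧) * ξ t)   ≈⟨ sumK-cong d (λ t → *-congʳ (sym (⟦lincomb⟧≈lincomb⟦⟧ r _ u m))) ⟩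
    sumK Q d (λ t → ⟦ lincomb F r (λ i → D i t) u m ⟧ * ξ t)        ∎
    where
    xy·z≈xz·y : ∀ x y z → (x * y) * z ≈ (x * z) * y
    xy·z≈xz·y x y z = trans (*-assoc x y z) (trans (*-congˡ (*-comm y z)) (sym (*-assoc x z y)))

  coordinateVectors : ∀ {k} → Vect Q k → Fin d → Vect F k
  coordinateVectors v t l = proj₁ (coordinates (v l)) t

  module _ {k : ℕ} {U : Vect F (suc (suc k)) → Set} where
    private
      module Fᵏ = SubfieldSpan (idₕ F) (suc (suc k))
      module Qᵏ = SubfieldSpan (idₕ Q) (suc (suc k))
      open Fᵏ.Finite EnumF (Enumeration._≟_ EnumF)

    cutting⇒covers : d ≤ suc k → IsCutting F U → CoversWith Q (ImageVec j U) k
    cutting⇒covers d≤k U-cutting v v≉0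
      with a , a≉0 , w⊆H ← hyperplaneThrough (s≤s d≤k) (coordinateVectors v)
      with g , w∈⟨g⟩ ← independentSpanningFamily {S = λ u → U u × InHyperplane F a u} (coordinateVectors v)
                          (λ t → U-cutting a a≉0 (coordinateVectors v t) (w⊆H t))
      = Qᵏ.InSpanₕ-pad {P = λ x → ImageVec j U x × ¬ EqV Q x (0v Q)} r≤k (⟦_⟧ᵛ ∘ Fᵏ.family g) ⟦g⟧∈L v≉0 v∈⟨⟦g⟧⟩
      where
      r≤k : Fᵏ.size g ≤ suc k
      r≤k = independent-in-hyperplane⇒≤ a≉0 (Fᵏ.independent g) (proj₂ ∘ Fᵏ.family∈S g)

      ⟦g⟧∈L : ∀ i → ImageVec j U ⟦ Fᵏ.family g i ⟧ᵛ × ¬ EqV Q ⟦ Fᵏ.family g i ⟧ᵛ (0v Q)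
      ⟦g⟧∈L i = (Fᵏ.family g i , proj₁ (Fᵏ.family∈S g i) , λ _ → refl) ,
                Fᵏ.Independent⇒≉0 (Fᵏ.independent g) i ∘ ⟦u⟧ᵛ≈0⇒u≈0 (Enumeration._≟_ EnumF)

      D : Fin d → Fin (Fᵏ.size g) → F.Carrier
      D = proj₁ ∘ w∈⟨g⟩

      v∈⟨⟦g⟧⟩ : Qᵏ.InSpanₕ (Fᵏ.size g) (⟦_⟧ᵛ ∘ Fᵏ.family g) v
      v∈⟨⟦g⟧⟩ = (λ i → sumK Q d (λ t → ⟦ D t i ⟧ * ξ t)) , λ l → begin
        v l                                                               ≈⟨ proj₂ (coordinates (v l)) ⟩
        sumK Q d (λ t → ⟦ coordinateVectors v t l ⟧ * ξ t)                ≈⟨ sumK-cong d (λ t → *-congʳ (cong (proj₂ (w∈⟨g⟩ t) l))) ⟩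
        sumK Q d (λ t → ⟦ lincomb F _ (D t) (Fᵏ.family g) l ⟧ * ξ t)       ≈⟨ basis-expansion _ (λ i t → D t i) (Fᵏ.family g) l ⟨
        lincomb Q _ (λ i → sumK Q d (λ t → ⟦ D t i ⟧ * ξ t)) (⟦_⟧ᵛ ∘ Fᵏ.family g) l ∎

  module _ {U : Vect F (suc d) → Set} where
    private
      module Fᵏ = SubfieldSpan (idₕ F) (suc d)
      open Fᵏ.Finite EnumF (Enumeration._≟_ EnumF)

      v₀ : Vect Q (suc d)
      v₀ = 0# ∷ ξ

      v₀≉0 : 0 < d → ¬ EqV Q v₀ (0v Q)
      v₀≉0 0<d v₀≈0 = ξ≉0 j B (Fin.fromℕ< 0<d) (v₀≈0 (Fin.suc (Fin.fromℕ< 0<d)))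

    -- Expanding the coefficients of a cover of v₀ = (0, ξ) in the basis ξ gives d independent
    -- vectors W t of F^(d+1) in the F-span of the s + 1 preimages of the covering points.
    covers⇒≤ : 0 < d → ∀ {s} → CoversWith Q (ImageVec j U) s → d ≤ suc s
    covers⇒≤ 0<d {s} covers with u , u∈L , c , v₀≈cu ← covers v₀ (v₀≉0 0<d) =
      independent-in-span⇒≤ {u = u'} W-independent (λ t → (λ i → D i t) , λ _ → F.refl)
      where
      u' : Fin (suc s) → Vect F (suc d)
      u' i = proj₁ (proj₁ (u∈L i))

      D : Fin (suc s) → Fin d → F.Carrier
      D i = proj₁ (coordinates (c i))

      W : Fin d → Vect F (suc d)
      W t = lincomb F (suc s) (λ i → D i t) u'

      W≈δ : ∀ t t' → W t (Fin.suc t') F.≈ δ F t' t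
      W≈δ t t' = coordinates-unique (λ t → W t (Fin.suc t')) (δ F t') (begin
        sumK Q d (λ t → ⟦ W t (Fin.suc t') ⟧ * ξ t)                        ≈⟨ basis-expansion (suc s) D u' (Fin.suc t') ⟨
        lincomb Q (suc s) (λ i → sumK Q d (λ t → ⟦ D i t ⟧ * ξ t)) (⟦_⟧ᵛ ∘ u') (Fin.suc t')
          ≈⟨ sumK-cong (suc s) (λ i → *-cong (sym (proj₂ (coordinates (c i)))) (sym (proj₂ (proj₂ (proj₁ (u∈L i))) (Fin.suc t')))) ⟩
        lincomb Q (suc s) c u (Fin.suc t')                                  ≈⟨ v₀≈cu (Fin.suc t') ⟨
        ξ t'                                                                ≈⟨ sumK-⟦δ⟧* d ξ t' ⟨
        sumK Q d (λ t → ⟦ δ F t' t ⟧ * ξ t)                                 ∎) t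

      W-independent : Fᵏ.Independent d W
      W-independent c' c'W≈0 t' = F.trans (F.sym (KroneckerSums.sumK-⟦δ⟧* (idₕ F) d c' t'))
        (F.trans (FiniteSums.sumK-cong F d (λ t → F.trans (F.*-comm _ _) (F.*-congˡ (F.sym (W≈δ t t'))))) (c'W≈0 (Fin.suc t')))

cutting⇒rankSaturating : ∀ {F Q : Field} (j : FieldHom F Q) {N : ℕ} → Enumeration (Field.setoid F) N →
  ∀ {k} → Basis j (suc k) → {U : Vect F (suc (suc k)) → Set} → IsCutting F U → RankSaturating Q (ImageVec j U) (suc k)
cutting⇒rankSaturating j EnumF B U-cutting =
  cutting⇒covers ℕ.≤-refl U-cutting , λ s s<k covers → ℕ.<⇒≱ s<k (ℕ.≤-pred (covers⇒≤ (s≤s z≤n) covers))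
  where open Saturation j EnumF B

theorem4p6 : (q m n k : ℕ) → IsPrimePower q → 1 ≤ m → 1 ≤ n → 2 ≤ k →
    (Fq Fqm FQ : Field) → HasSize Fq q → HasSize Fqm (q ^ m) →
    HasSize FQ (q ^ (m ℕ.* (k ∸ 1))) →
    (ι : FieldHom Fq Fqm) (j : FieldHom Fqm FQ) →
    (U : Vect Fqm k → Set) →
    IsSystem ι n k U → IsCutting Fqm U →
    IsSystem (j ∘ₕ ι) n k (ImageVec j U) × RankSaturating FQ (ImageVec j U) (k ∸ 1)
theorem4p6 q m n (suc (suc k)) _ _ _ (s≤s (s≤s z≤n)) Fq Fqm FQ _ |Fqm| |FQ| ι j U U-system U-cutting =
  ExtensionOfScalars.ImageVec-isSystem ι j U (Enumeration._≟_ EnumFqm) U-system ,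
  cutting⇒rankSaturating j EnumFqm B U-cutting
  where
  EnumFqm : Enumeration (Field.setoid Fqm) (q ^ m)
  EnumFqm = fieldEnumeration Fqm |Fqm|

  B : Basis j (suc k)
  B = basisOfSize j EnumFqm (fieldEnumeration FQ (≡.subst (HasSize FQ) (≡.sym (ℕ.^-*-assoc q m (suc k))) |FQ|))
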